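{- Let $P$ be a polygon with vertex set $V$ and let $D$ be a dissection of $P$ of the form $D=\{d\}\sqcup D_2$, where $d=\{\zeta,\eta\}$ divides $P$ into subpolygons $P_1$ (vertex set $V_1=\{\varepsilon\in V : \zeta\le\varepsilon\le\eta\}$) and $P_2$ (vertex set $V_2=\{\varepsilon\in V:\eta\le\varepsilon\le\zeta\}$), and $D_2$ is a dissection of $P_2$. If $\alpha,\beta\in V_2$ with $\alpha\neq\beta$, then $\mathcal{T}_{P,D}(\alpha,\beta)=\mathcal{T}_{P_2,D_2}(\alpha,\beta)$.
   Context: A polygon $P$ is a finite set $V$ of at least three vertices with a cyclic order, pictured as a convex polygon in the plane; for vertices $\zeta,\eta$, the notation $\zeta\le\varepsilon\le\eta$ means that $\varepsilon$ lies on the arc of the cyclic order going from $\zeta$ to $\eta$ in the positive direction (endpoints included; strict inequalities exclude the endpoints). A subpolygon is a subset of $V$ with at least three vertices and the induced cyclic order. A diagonal is a two-element subset of $V$. Edges are $\{\alpha,\alpha^+\}$ ($\alpha^+$ successor); other diagonals are internal. Diagonals $\{\alpha,\beta\}$, $\{\gamma,\delta\}$ cross if the four vertices are distinct and appear in cyclic order $\alpha,\gamma,\beta,\delta$ or $\alpha,\delta,\beta,\gamma$. A dissection is a set of pairwise non-crossing internal diagonals (possibly empty). For vertices $\pi_1\neq\pi_p$, a $T$-path from $\pi_1$ to $\pi_p$ with respect to $D$ is a tuple $(\pi_1,\dots,\pi_p)$ of vertices such that: (i) $\{\pi_1,\pi_2\},\dots,\{\pi_{p-1},\pi_p\}$ are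 pairwise different diagonals; (ii) no $\{\pi_i,\pi_{i+1}\}$ crosses a diagonal of $D$; (iii) each $\{\pi_{2j},\pi_{2j+1}\}$ lies in $D$, and these diagonals cross $\{\pi_1,\pi_p\}$ at pairwise different points progressing monotonically in the direction from $\pi_1$ to $\pi_p$. $\mathcal{T}_{P,D}(\alpha,\beta)$ is the set of $T$-paths from $\alpha$ to $\beta$ with respect to $D$ in $P$ (and similarly $\mathcal{T}_{P_2,D_2}$ for the subpolygon $P_2$). -}

module Defs where

open import Data.Nat using (ℕ; zero; suc)
open import Data.Fin using (Fin; toℕ)
open import Data.Fin as F using ()
open import Data.Product using (Σ; ∃; _×_; _,_)
open import Data.Sum using (_⊎_)
open import Data.Maybe using (just)
open import Data.List using (List; []; _∷_; head; last)
open import Data.List.Relation.Unary.All using (All)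
open import Data.List.Relation.Unary.Any using (Any)
open import Data.List.Relation.Unary.AllPairs using (AllPairs)
open import Data.List.Membership.Propositional using (_∈_)
open import Relation.Binary.PropositionalEquality using (_≡_; _≢_)
open import Relation.Nullary using (¬_)

-- Convention: the ambient vertices are Fin n with the cyclic order
-- 0 → 1 → … → n-1 → 0.  A polygon is a subset S : Fin n → Set (at least
-- three vertices) with the induced cyclic order.  Every polygon is of
-- this form up to isomorphism, and subpolygons are again of this form.

Vertex : ℕ → Set
Vertex n = Fin n

Polygon : ℕ → Set₁
Polygon n = Fin n → Set

-- Strict cyclic betweenness: x lies strictly inside the arc going from a
-- to b in the positive direction (a ≠ b intended).
Btw : ∀ {n} → Fin n → Fin n → Fin n → Set
Btw a x b = ((a F.< b) × (a F.< x) × (x F.< b))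
          ⊎ ((b F.< a) × (a F.< x))
          ⊎ ((b F.< a) × (x F.< b))

ArcW : ∀ {n} → Fin n → Fin n → Fin n → Set
ArcW a x b = (x ≡ a) ⊎ (x ≡ b) ⊎ Btw a x b

AtLeast3 : ∀ {n} → Polygon n → Set
AtLeast3 S = ∃ λ x → ∃ λ y → ∃ λ z →
  S x × S y × S z × x ≢ y × y ≢ z × x ≢ z

-- Diagonals are represented by ordered pairs; two pairs denote the same
-- diagonal (two-element set) iff they agree up to swapping.
Diag : ℕ → Set
Diag n = Fin n × Fin n

SameDiag : ∀ {n} → Diag n → Diag n → Set
SameDiag (a , b) (c , d) = ((a ≡ c) × (b ≡ d)) ⊎ ((a ≡ d) × (b ≡ c))

Orient : ∀ {n} → Diag n → Fin n → Fin n → Set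
Orient (x , y) a b = ((a ≡ x) × (b ≡ y)) ⊎ ((a ≡ y) × (b ≡ x))

Cross : ∀ {n} → Diag n → Diag n → Set
Cross (α , β) (γ , δ) =
  α ≢ β × α ≢ γ × α ≢ δ × β ≢ γ × β ≢ δ × γ ≢ δ ×
  ((Btw α γ β × Btw β δ α) ⊎ (Btw α δ β × Btw β γ α))

IsSucc : ∀ {n} → Polygon n → Fin n → Fin n → Set
IsSucc S α σ = S σ × σ ≢ α × (∀ ε → S ε → ¬ Btw α ε σ)

Internal : ∀ {n} → Polygon n → Diag n → Set
Internal S (a , b) = S a × S b × a ≢ b × ¬ IsSucc S a b × ¬ IsSucc S b a

InD : ∀ {n} → List (Diag n) → Diag n → Set
InD D e = Any (SameDiag e) D

Dissection : ∀ {n} → Polygon n → List (Diag n) → Set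
Dissection S D = All (Internal S) D × (∀ e f → e ∈ D → f ∈ D → ¬ Cross e f)

steps : ∀ {A : Set} → List A → List (A × A)
steps []           = []
steps (x ∷ [])     = []
steps (x ∷ y ∷ xs) = (x , y) ∷ steps (y ∷ xs)

evens : ∀ {A : Set} → List A → List A
evens []           = []
evens (x ∷ [])     = []
evens (x ∷ y ∷ xs) = y ∷ evens xs

-- For diagonals e, e' both crossing the segment from s to t, "e crosses it
-- strictly before e'" (going from s to t).  Orient e as (a , b) with a on
-- the open arc s→t and b on the open arc t→s (likewise e' as (a' , b'));
-- in convex position the crossing point of e' lies strictly further from s
-- than that of e iff a ≤ a' along the arc s→t, b' ≤ b along the arc t→s,
-- and (a , b) ≠ (a' , b').
Before : ∀ {n} → Fin n → Fin n → Diag n → Diag n → Set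
Before s t e e' = ∃ λ a → ∃ λ b → ∃ λ a' → ∃ λ b' →
  Orient e a b × Orient e' a' b' ×
  Btw s a t × Btw t b s × Btw s a' t × Btw t b' s ×
  ArcW a a' t × ArcW b' b s × ¬ ((a ≡ a') × (b ≡ b'))

record TPath {n} (S : Polygon n) (D : List (Diag n)) (α β : Fin n)
             (π : List (Fin n)) : Set where
  field
    endpoints-distinct : α ≢ β
    starts    : head π ≡ just α
    ends      : last π ≡ just β
    vertices  : All S π
    step-diag : All (λ e → Σ (Fin n) λ x → Σ (Fin n) λ y → e ≡ (x , y) × x ≢ y) (steps π)
    step-distinct : AllPairs (λ e f → ¬ SameDiag e f) (steps π)
    no-cross  : All (λ e → ∀ f → InD D f → ¬ Cross e f) (steps π)
    even-in-D : All (InD D) (evens (steps π))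
    even-cross : All (λ e → Cross e (α , β)) (evens (steps π))
    even-monotone : AllPairs (Before α β) (evens (steps π))

module Submission where

-- The dividing diagonal d = {ζ, η} can be added to or removed
-- from the dissection without affecting T-paths whose endpoints α, β lie on
-- the closed arc from η to ζ, and T-paths whose even steps lie in D₂ may be
-- regarded as living in P or in P₂ indifferently.
--
-- Every vertex of a T-path is an endpoint of it or
--     an endpoint of an even step, and even steps lie in the dissection; so a
--     T-path for S stays one for any S' containing α, β and the endpoints of
--     the diagonals of the dissection.
--   * Changing the dissection.
--
-- Lemma 3.4: forward, drop d (it does not cross {α, β}) and move to P₂;
-- backward, move to P and add d (no step of a path in P₂ crosses d).

open import Defs
open import Data.Nat using (ℕ)
open import Data.Fin using (Fin)
open import Data.Fin.Properties using (<-asym; <-trans)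
open import Data.Product using (_×_; _,_; proj₁; proj₂)
open import Data.Sum using (inj₁; inj₂; swap)
open import Data.Empty using (⊥-elim)
open import Data.Maybe using (just)
open import Data.Maybe.Properties using (just-injective)
open import Data.List using (List; []; _∷_; head; last)
open import Data.List.Relation.Unary.All as All using (All; []; _∷_)
open import Data.List.Relation.Unary.Any using (here; there)
open import Relation.Binary.PropositionalEquality using (_≡_; _≢_; refl; sym; trans; subst; ≢-sym)
open import Relation.Nullary using (¬_)
open import Function.Bundles using (_⇔_; mk⇔)

module _ {n : ℕ} where

  btw-rotate : {a x b : Fin n} → Btw a x b → Btw x b a
  btw-rotate (inj₁ (_ , a<x , x<b))     = inj₂ (inj₁ (a<x , x<b))
  btw-rotate (inj₂ (inj₁ (b<a , a<x)))  = inj₂ (inj₂ (a<x , b<a))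
  btw-rotate (inj₂ (inj₂ (b<a , x<b)))  = inj₁ (<-trans x<b b<a , x<b , b<a)

  btw-asym : {a x b : Fin n} → Btw a x b → ¬ Btw b x a
  btw-asym (inj₁ (a<b , _ , _)) (inj₁ (b<a , _ , _))         = <-asym a<b b<a
  btw-asym (inj₁ (_ , _ , x<b)) (inj₂ (inj₁ (_ , b<x)))      = <-asym x<b b<x
  btw-asym (inj₁ (_ , a<x , _)) (inj₂ (inj₂ (_ , x<a)))      = <-asym a<x x<a
  btw-asym (inj₂ (inj₁ (_ , a<x))) (inj₁ (_ , _ , x<a))      = <-asym a<x x<a
  btw-asym (inj₂ (inj₁ (b<a , _))) (inj₂ (inj₁ (a<b , _)))   = <-asym b<a a<b
  btw-asym (inj₂ (inj₁ (b<a , _))) (inj₂ (inj₂ (a<b , _)))   = <-asym b<a a<b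
  btw-asym (inj₂ (inj₂ (_ , x<b))) (inj₁ (_ , b<x , _))      = <-asym x<b b<x
  btw-asym (inj₂ (inj₂ (b<a , _))) (inj₂ (inj₁ (a<b , _)))   = <-asym b<a a<b
  btw-asym (inj₂ (inj₂ (b<a , _))) (inj₂ (inj₂ (a<b , _)))   = <-asym b<a a<b

  btw-trans : {a b c d : Fin n} → Btw a b c → Btw a c d → Btw b c d
  btw-trans (inj₁ (_ , _ , b<c))    (inj₁ (_ , _ , c<d))        = inj₁ (<-trans b<c c<d , b<c , c<d)
  btw-trans (inj₁ (_ , a<b , b<c))  (inj₂ (inj₁ (d<a , _)))     = inj₂ (inj₁ (<-trans d<a a<b , b<c))
  btw-trans (inj₁ (a<c , _ , _))    (inj₂ (inj₂ (d<a , c<d)))   = ⊥-elim (<-asym a<c (<-trans c<d d<a))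
  btw-trans (inj₂ (inj₁ (c<a , _))) (inj₁ (_ , a<c , _))        = ⊥-elim (<-asym a<c c<a)
  btw-trans (inj₂ (inj₁ (c<a , _))) (inj₂ (inj₁ (_ , a<c)))     = ⊥-elim (<-asym a<c c<a)
  btw-trans (inj₂ (inj₁ (_ , a<b))) (inj₂ (inj₂ (d<a , c<d)))   = inj₂ (inj₂ (<-trans d<a a<b , c<d))
  btw-trans (inj₂ (inj₂ (c<a , _))) (inj₁ (_ , a<c , _))        = ⊥-elim (<-asym a<c c<a)
  btw-trans (inj₂ (inj₂ (c<a , _))) (inj₂ (inj₁ (_ , a<c)))     = ⊥-elim (<-asym a<c c<a)
  btw-trans (inj₂ (inj₂ (_ , b<c))) (inj₂ (inj₂ (_ , c<d)))     = inj₁ (<-trans b<c c<d , b<c , c<d)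

  arc-interior : {a x b : Fin n} → ArcW a x b → x ≢ a → x ≢ b → Btw a x b
  arc-interior (inj₁ x≡a)          x≢a _   = ⊥-elim (x≢a x≡a)
  arc-interior (inj₂ (inj₁ x≡b))   _   x≢b = ⊥-elim (x≢b x≡b)
  arc-interior (inj₂ (inj₂ a<x<b)) _   _   = a<x<b

  arc-not-separated : {η ζ x y : Fin n} → Btw η y ζ → Btw x ζ y → ¬ Btw y η x
  arc-not-separated ηyζ xζy yηx =
    btw-asym (btw-trans (btw-rotate yηx) ηyζ) (btw-rotate xζy)

  arc-chord-no-cross : {η ζ x y : Fin n} → ArcW η x ζ → ArcW η y ζ → ¬ Cross (x , y) (ζ , η)
  arc-chord-no-cross _ y∈arc (_ , _ , _ , y≢ζ , y≢η , _ , inj₁ (xζy , yηx)) =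
    arc-not-separated (arc-interior y∈arc y≢η y≢ζ) xζy yηx
  arc-chord-no-cross x∈arc _ (_ , x≢ζ , x≢η , _ , _ , _ , inj₂ (xηy , yζx)) =
    arc-not-separated (arc-interior x∈arc x≢η x≢ζ) yζx xηy

  cross-swapˡ : {a b c d : Fin n} → Cross (a , b) (c , d) → Cross (b , a) (c , d)
  cross-swapˡ (a≢b , a≢c , a≢d , b≢c , b≢d , c≢d , inj₁ (acb , bda)) =
    (λ b≡a → a≢b (sym b≡a)) , b≢c , b≢d , a≢c , a≢d , c≢d , inj₂ (bda , acb)
  cross-swapˡ (a≢b , a≢c , a≢d , b≢c , b≢d , c≢d , inj₂ (adb , bca)) =
    (λ b≡a → a≢b (sym b≡a)) , b≢c , b≢d , a≢c , a≢d , c≢d , inj₁ (bca , adb)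

  cross-swapʳ : {a b c d : Fin n} → Cross (a , b) (c , d) → Cross (a , b) (d , c)
  cross-swapʳ (a≢b , a≢c , a≢d , b≢c , b≢d , c≢d , crossing) =
    a≢b , a≢d , a≢c , b≢d , b≢c , (λ d≡c → c≢d (sym d≡c)) , swap crossing

  cross-congˡ : {e e' f : Diag n} → SameDiag e e' → Cross e f → Cross e' f
  cross-congˡ (inj₁ (refl , refl)) = λ c → c
  cross-congˡ (inj₂ (refl , refl)) = cross-swapˡ

  cross-congʳ : {e f f' : Diag n} → SameDiag f f' → Cross e f → Cross e f'
  cross-congʳ (inj₁ (refl , refl)) = λ c → c
  cross-congʳ (inj₂ (refl , refl)) = cross-swapʳ

  -- ... and is symmetric: cyclic order a c b d is also cyclic order c b d a.
  cross-sym : {a b c d : Fin n} → Cross (a , b) (c , d) → Cross (c , d) (a , b)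
  cross-sym (a≢b , a≢c , a≢d , b≢c , b≢d , c≢d , inj₁ (acb , bda)) =
    c≢d , ≢-sym a≢c , ≢-sym b≢c , ≢-sym a≢d , ≢-sym b≢d , a≢b ,
    inj₂ (btw-trans acb (btw-rotate (btw-rotate bda)) , btw-trans bda (btw-rotate (btw-rotate acb)))
  cross-sym (a≢b , a≢c , a≢d , b≢c , b≢d , c≢d , inj₂ (adb , bca)) =
    c≢d , ≢-sym a≢c , ≢-sym b≢c , ≢-sym a≢d , ≢-sym b≢d , a≢b ,
    inj₁ (btw-trans bca (btw-rotate (btw-rotate adb)) , btw-trans adb (btw-rotate (btw-rotate bca)))

Ends : {A : Set} → (A → Set) → A × A → Set
Ends S e = S (proj₁ e) × S (proj₂ e)

module _ {A : Set} {S : A → Set} where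

  steps-ends : (π : List A) → All S π → All (Ends S) (steps π)
  steps-ends []           _                = []
  steps-ends (x ∷ [])     _                = []
  steps-ends (x ∷ y ∷ π)  (sx ∷ sy ∷ sπ)   = (sx , sy) ∷ steps-ends (y ∷ π) (sy ∷ sπ)

  -- Every entry of a tuple is its first or last entry or an end of one of
  -- its even steps.  Hence the vertex condition of a T-path follows from
  -- its endpoints and its even steps.
  vertices-covered : (x : A) (π : List A) → S x → (∀ b → last (x ∷ π) ≡ just b → S b) →
                     All (Ends S) (evens (steps (x ∷ π))) → All S (x ∷ π)
  vertices-covered x []          sx _      _                   = sx ∷ []
  vertices-covered x (y ∷ [])    sx s-last _                   = sx ∷ s-last y refl ∷ []
  vertices-covered x (y ∷ z ∷ π) sx s-last ((sy , sz) ∷ even)  =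
    sx ∷ sy ∷ vertices-covered z π sz s-last even

module _ {n : ℕ} where

  dissection-ends : {S : Polygon n} {D : List (Diag n)} {e : Diag n} →
                    All (Internal S) D → InD D e → Ends S e
  dissection-ends ((sa , sb , _) ∷ _) (here (inj₁ (refl , refl))) = sa , sb
  dissection-ends ((sa , sb , _) ∷ _) (here (inj₂ (refl , refl))) = sb , sa
  dissection-ends (_ ∷ internal) (there e∈D) = dissection-ends internal e∈D

  open TPath

  -- A T-path for S is one for any S' containing α, β and the ends of the
  -- diagonals of D: only the vertex condition mentions the polygon.
  retarget : {S S' : Polygon n} {D : List (Diag n)} {α β : Fin n} {π : List (Fin n)} →
             (∀ {e} → InD D e → Ends S' e) → S' α → S' β →
             TPath S D α β π → TPath S' D α β π
  retarget {S' = S'} {α = α} {β} {π} D⊆S' s'α s'β t = record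
    { endpoints-distinct = endpoints-distinct t
    ; starts        = starts t
    ; ends          = ends t
    ; vertices      = vertices-of π (starts t) (ends t) (All.map D⊆S' (even-in-D t))
    ; step-diag     = step-diag t
    ; step-distinct = step-distinct t
    ; no-cross      = no-cross t
    ; even-in-D     = even-in-D t
    ; even-cross    = even-cross t
    ; even-monotone = even-monotone t
    }
    where
    vertices-of : (ρ : List (Fin n)) → head ρ ≡ just α → last ρ ≡ just β →
                  All (Ends S') (evens (steps ρ)) → All S' ρ
    vertices-of (x ∷ ρ) refl last≡β even = vertices-covered x ρ s'α s'-last even
      where
      s'-last : ∀ b → last (x ∷ ρ) ≡ just b → S' b
      s'-last b last≡b = subst S' (just-injective (trans (sym last≡β) last≡b)) s'β

  -- A diagonal not crossing {α, β} can be no even step of a T-path from α to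
  -- β, so it may be removed from the dissection.
  drop-diagonal : {S : Polygon n} {d : Diag n} {D : List (Diag n)} {α β : Fin n} {π : List (Fin n)} →
                  ¬ Cross d (α , β) → TPath S (d ∷ D) α β π → TPath S D α β π
  drop-diagonal {d = d} {D} {α} {β} d∤αβ t = record
    { endpoints-distinct = endpoints-distinct t
    ; starts        = starts t
    ; ends          = ends t
    ; vertices      = vertices t
    ; step-diag     = step-diag t
    ; step-distinct = step-distinct t
    ; no-cross      = All.map (λ avoids f f∈D → avoids f (there f∈D)) (no-cross t)
    ; even-in-D     = All.zipWith even-not-d (even-in-D t , even-cross t)
    ; even-cross    = even-cross t
    ; even-monotone = even-monotone t
    }
    where
    even-not-d : ∀ {e} → InD (d ∷ D) e × Cross e (α , β) → InD D e
    even-not-d (here e≡d , e×αβ) = ⊥-elim (d∤αβ (cross-congˡ e≡d e×αβ))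
    even-not-d (there e∈D , _)   = e∈D

  add-diagonal : {S : Polygon n} {d : Diag n} {D : List (Diag n)} {α β : Fin n} {π : List (Fin n)} →
                 All (λ e → ¬ Cross e d) (steps π) → TPath S D α β π → TPath S (d ∷ D) α β π
  add-diagonal {d = d} {D} steps∤d t = record
    { endpoints-distinct = endpoints-distinct t
    ; starts        = starts t
    ; ends          = ends t
    ; vertices      = vertices t
    ; step-diag     = step-diag t
    ; step-distinct = step-distinct t
    ; no-cross      = All.zipWith avoids-all (steps∤d , no-cross t)
    ; even-in-D     = All.map there (even-in-D t)
    ; even-cross    = even-cross t
    ; even-monotone = even-monotone t
    }
    where
    avoids-all : ∀ {e} → ¬ Cross e d × (∀ f → InD D f → ¬ Cross e f) → ∀ f → InD (d ∷ D) f → ¬ Cross e f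
    avoids-all (e∤d , _) f (here f≡d)  e×f = e∤d (cross-congʳ f≡d e×f)
    avoids-all (_ , e∤D) f (there f∈D) = e∤D f f∈D

lemma3p4 : ∀ {n} (P : Polygon n) (ζ η : Fin n) (D₂ : List (Diag n)) →
    AtLeast3 P →
    Internal P (ζ , η) →
    Dissection P ((ζ , η) ∷ D₂) →
    ¬ InD D₂ (ζ , η) →
    Dissection (λ ε → P ε × ArcW η ε ζ) D₂ →
    (α β : Fin n) → (P α × ArcW η α ζ) → (P β × ArcW η β ζ) → α ≢ β →
    (π : List (Fin n)) →
    TPath P ((ζ , η) ∷ D₂) α β π ⇔ TPath (λ ε → P ε × ArcW η ε ζ) D₂ α β π
lemma3p4 P ζ η D₂ _ _ (internal , _) _ (internal₂ , _) α β α∈P₂ β∈P₂ _ π =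
  mk⇔ to-P₂ to-P
  where
  -- d does not cross {α, β}, since α and β lie on the arc η → ζ.
  d∤αβ : ¬ Cross (ζ , η) (α , β)
  d∤αβ d×αβ = arc-chord-no-cross (proj₂ α∈P₂) (proj₂ β∈P₂) (cross-sym d×αβ)

  to-P₂ : TPath P ((ζ , η) ∷ D₂) α β π → TPath (λ ε → P ε × ArcW η ε ζ) D₂ α β π
  to-P₂ t = retarget (dissection-ends internal₂) α∈P₂ β∈P₂ (drop-diagonal d∤αβ t)

  -- Conversely, every step of a T-path in P₂ joins vertices of the arc η → ζ,
  -- so it does not cross d.
  to-P : TPath (λ ε → P ε × ArcW η ε ζ) D₂ α β π → TPath P ((ζ , η) ∷ D₂) α β π
  to-P t = retarget (dissection-ends internal) (proj₁ α∈P₂) (proj₁ β∈P₂)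
             (add-diagonal steps∤d t)
    where
    steps∤d : All (λ e → ¬ Cross e (ζ , η)) (steps π)
    steps∤d = All.map (λ (x∈P₂ , y∈P₂) → arc-chord-no-cross (proj₂ x∈P₂) (proj₂ y∈P₂))
                      (steps-ends π (TPath.vertices t))
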